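{- Let $\mathcal{L}\subseteq\mathbf{Z}^n$ be a lattice. Suppose $\sum_i c_i(\alpha_i-\beta_i)=0$ is a finite sum with all $c_i>0$, where each $\alpha_i-\beta_i$ belongs to the Graver basis $Gr_{\mathcal{L}}$, $\alpha_i,\beta_i\in\mathbf{N}^n$ and $\mathrm{supp}(\alpha_i)\cap\mathrm{supp}(\beta_i)=\emptyset$. Then $x^v=\mathrm{lcm}_i(x^{\alpha_i})$ lies in the vertex ideal $V_{\mathcal{L}}$.
   Context: $S=k[x_1,\ldots,x_n]$, $x^u=\prod_i x_i^{u_i}$, $\mathrm{supp}(u)=\{i: u_i\neq 0\}$. For $u\in\mathbf{N}^n$ the fiber is $P_u=\mathrm{conv}\{v\in\mathbf{N}^n: u-v\in\mathcal{L}\}$; the vertex ideal $V_{\mathcal{L}}$ is the monomial ideal spanned by monomials $x^v$ with $v$ not a vertex of $P_v$. Graver basis: for each sign pattern $\rho\in\{+,-\}^n$ let $\mathbf{R}_\rho$ be the corresponding closed orthant; $\mathcal{L}\cap\mathbf{R}_\rho$ is a finitely generated monoid with a unique minimal generating set (Hilbert basis) $H_\rho$; $Gr_{\mathcal{L}}=\bigcup_\rho H_\rho$.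
   Formalization: The positive coefficients $c_i$ in the relation are taken to be rational numbers. -}

module Defs where

open import Data.Nat as ℕ using (ℕ; zero; suc; _⊔_)
open import Data.Integer as ℤ using (ℤ; +_)
open import Data.Rational as ℚ using (ℚ; 0ℚ; 1ℚ)
open import Data.Fin using (Fin; zero; suc)
open import Data.Vec using (Vec; replicate; zipWith; map; lookup; foldr′)
open import Data.Vec.Relation.Binary.Pointwise.Inductive using (Pointwise)
open import Data.List as List using (List)
open import Data.List.Relation.Unary.All using (All)
open import Data.Bool using (Bool; true; false; if_then_else_)
open import Data.Product using (Σ; ∃; _×_; _,_)
open import Data.Sum using (_⊎_)
open import Relation.Nullary using (¬_)
open import Relation.Binary.PropositionalEquality using (_≡_)

ℤⁿ : ℕ → Set
ℤⁿ n = Vec ℤ n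

ℕⁿ : ℕ → Set
ℕⁿ n = Vec ℕ n

ℚⁿ : ℕ → Set
ℚⁿ n = Vec ℚ n

SubZ : ℕ → Set₁
SubZ n = ℤⁿ n → Set

record IsLattice {n : ℕ} (L : SubZ n) : Set where
  field
    has-zero : L (replicate n (+ 0))
    closed-+ : ∀ u v → L u → L v → L (zipWith ℤ._+_ u v)
    closed-neg : ∀ u → L u → L (map ℤ.-_ u)

InOrthant : {n : ℕ} → Vec Bool n → ℤⁿ n → Set
InOrthant {n} ρ u = ∀ (i : Fin n) →
  if lookup ρ i then (+ 0 ℤ.≤ lookup u i) else (lookup u i ℤ.≤ + 0)

OrthantMonoid : {n : ℕ} → SubZ n → Vec Bool n → SubZ n
OrthantMonoid L ρ u = L u × InOrthant ρ u

sumZ : {n : ℕ} → List (ℤⁿ n) → ℤⁿ n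
sumZ {n} = List.foldr (zipWith ℤ._+_) (replicate n (+ 0))

-- u is in the monoid generated by H (finite ℕ-combination = sum of a list)
GeneratedBy : {n : ℕ} → SubZ n → ℤⁿ n → Set
GeneratedBy {n} H u = Σ (List (ℤⁿ n)) λ xs → All H xs × sumZ xs ≡ u

IsGeneratingSet : {n : ℕ} → SubZ n → SubZ n → Set
IsGeneratingSet M H = (∀ u → H u → M u) × (∀ u → M u → GeneratedBy H u)

IsMinimalGeneratingSet : {n : ℕ} → SubZ n → SubZ n → Set₁
IsMinimalGeneratingSet {n} M H =
  IsGeneratingSet M H ×
  ((H' : SubZ n) → (∀ u → H' u → H u) → IsGeneratingSet M H' → ∀ u → H u → H' u)

-- Graver basis: union over sign patterns of the (unique) minimal generating
-- set (Hilbert basis) H_ρ of L ∩ R_ρ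
InGraver : {n : ℕ} → SubZ n → ℤⁿ n → Set₁
InGraver {n} L g = Σ (Vec Bool n) λ ρ → Σ (SubZ n) λ H →
  IsMinimalGeneratingSet (OrthantMonoid L ρ) H × H g

ℕ→ℚ : ℕ → ℚ
ℕ→ℚ k = (+ k) ℚ./ 1

toℤⁿ : {n : ℕ} → ℕⁿ n → ℤⁿ n
toℤⁿ = map +_

toℚⁿ : {n : ℕ} → ℕⁿ n → ℚⁿ n
toℚⁿ = map ℕ→ℚ

Fiber : {n : ℕ} → SubZ n → ℕⁿ n → ℕⁿ n → Set
Fiber L u w = L (zipWith ℤ._-_ (toℤⁿ u) (toℤⁿ w))

ConvexHull : {n : ℕ} → (ℕⁿ n → Set) → ℚⁿ n → Set
ConvexHull {n} S p = Σ (List (ℚ × ℕⁿ n)) λ cs →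
  All (λ { (t , w) → (0ℚ ℚ.≤ t) × S w }) cs ×
  (List.foldr (λ { (t , w) acc → t ℚ.+ acc }) 0ℚ cs ≡ 1ℚ) ×
  (List.foldr (λ { (t , w) acc → zipWith ℚ._+_ (map (t ℚ.*_) (toℚⁿ w)) acc })
              (replicate n 0ℚ) cs ≡ p)

dot : {n : ℕ} → ℚⁿ n → ℚⁿ n → ℚ
dot c p = foldr′ ℚ._+_ 0ℚ (zipWith ℚ._*_ c p)

IsVertex : {n : ℕ} → (ℚⁿ n → Set) → ℚⁿ n → Set
IsVertex {n} P v = P v × Σ (ℚⁿ n) λ c →
  ∀ p → P p → (dot c p ℚ.< dot c v) ⊎ (p ≡ v)

FiberPolyhedron : {n : ℕ} → SubZ n → ℕⁿ n → ℚⁿ n → Set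
FiberPolyhedron L u = ConvexHull (Fiber L u)

-- membership of the monomial x^v in the vertex ideal V_L, the monomial ideal
-- generated by the x^w with w not a vertex of P_w:  some generator divides x^v
InVertexIdeal : {n : ℕ} → SubZ n → ℕⁿ n → Set
InVertexIdeal {n} L v = Σ (ℕⁿ n) λ w →
  Pointwise ℕ._≤_ w v × ¬ IsVertex (FiberPolyhedron L w) (toℚⁿ w)

lcmExp : {m n : ℕ} → (Fin (ℕ.suc m) → ℕⁿ n) → ℕⁿ n
lcmExp {zero} α = α zero
lcmExp {ℕ.suc m} α = zipWith _⊔_ (α zero) (lcmExp (λ j → α (suc j)))

sumQ : {m n : ℕ} → (Fin m → ℚⁿ n) → ℚⁿ n
sumQ {zero} {n} f = replicate n 0ℚ
sumQ {ℕ.suc m} f = zipWith ℚ._+_ (f zero) (sumQ (λ j → f (suc j)))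

diffZ : {n : ℕ} → ℕⁿ n → ℕⁿ n → ℤⁿ n
diffZ a b = zipWith ℤ._-_ (toℤⁿ a) (toℤⁿ b)

ℤ→ℚ : ℤ → ℚ
ℤ→ℚ z = z ℚ./ 1

{-# OPTIONS --safe #-}
-- Put v = lcm_j α j and p j = v - α j + β j ∈ ℕⁿ.  Then v - p j = α j - β j is a
-- Graver element, so p j lies in the fiber of v, and p j ≠ v because Graver elements
-- are nonzero.  If some functional d exposed v in P_v we would have d·(α j - β j) > 0
-- for every j, and then d · Σ c j (α j - β j) > 0, contradicting Σ c j (α j - β j) = 0.
-- So v is not a vertex of P_v, and x^v is one of the generators of V_L.
module Submission where

open import Defs
open import Data.Nat as ℕ using (ℕ; zero; suc; _∸_; _⊔_)
import Data.Nat.Properties as ℕ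
open import Data.Integer as ℤ using (ℤ; +_)
import Data.Integer.Properties as ℤ
open import Data.Integer.Tactic.RingSolver using (solve-∀)
open import Data.Rational as ℚ using (ℚ; 0ℚ; 1ℚ; _+_; _*_; _<_; _≤_)
import Data.Rational.Properties as ℚ
import Data.Rational.Unnormalised as ℚᵘ
import Data.Rational.Unnormalised.Properties as ℚᵘ
open import Data.Rational.Solver using (module +-*-Solver)
open import Data.Fin using (Fin; zero; suc)
open import Data.Vec using ([]; _∷_; lookup; map; replicate; zipWith)
import Data.Vec.Properties as Vec
open import Data.Vec.Relation.Binary.Pointwise.Inductive as Pointwise
  using (Pointwise; []; _∷_)
open import Data.List using (List; []; _∷_; filter)
open import Data.List.Relation.Unary.All as All using ([]; _∷_)
open import Data.List.Relation.Unary.All.Properties using (all-filter; filter⁺)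
open import Data.Product using (_×_; _,_; proj₁; proj₂)
open import Data.Sum using (_⊎_; inj₁; inj₂)
open import Function using (_∘_)
open import Relation.Nullary using (¬_; yes; no; ¬?; contradiction)
open import Relation.Binary.PropositionalEquality
  using (_≡_; refl; sym; trans; cong; cong₂; subst; module ≡-Reasoning)

open +-*-Solver using (solve; _:+_; _:*_; _:=_)

0ℤⁿ : (n : ℕ) → ℤⁿ n
0ℤⁿ n = replicate n (+ 0)

sumZ-filter-nonzero : ∀ {n} (xs : List (ℤⁿ n)) →
  sumZ (filter (¬? ∘ Vec.≡-dec ℤ._≟_ (0ℤⁿ n)) xs) ≡ sumZ xs
sumZ-filter-nonzero [] = refl
sumZ-filter-nonzero {n} (x ∷ xs) with Vec.≡-dec ℤ._≟_ (0ℤⁿ n) x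
... | yes refl = trans (sumZ-filter-nonzero xs)
                   (sym (Vec.zipWith-identityˡ ℤ.+-identityˡ (sumZ xs)))
... | no _     = cong (zipWith ℤ._+_ x) (sumZ-filter-nonzero xs)

without-zeros : ∀ {n} {H : SubZ n} {u : ℤⁿ n} → GeneratedBy H u →
  GeneratedBy (λ x → H x × ¬ 0ℤⁿ n ≡ x) u
without-zeros {n} (xs , Hxs , sum≡u) =
  filter (¬? ∘ Vec.≡-dec ℤ._≟_ (0ℤⁿ n)) xs ,
  All.zip (filter⁺ _ Hxs , all-filter _ xs) ,
  trans (sumZ-filter-nonzero xs) sum≡u

minimalGeneratingSet-nonzero : ∀ {n} {M H : SubZ n} → IsMinimalGeneratingSet M H →
  ∀ u → H u → ¬ 0ℤⁿ n ≡ u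
minimalGeneratingSet-nonzero ((H⊆M , generates) , minimal) u Hu =
  proj₂ (minimal _ (λ _ → proj₁) ((λ x → H⊆M x ∘ proj₁) , λ x → without-zeros ∘ generates x) u Hu)

graver⊆lattice : ∀ {n} {L : SubZ n} {g : ℤⁿ n} → InGraver L g → L g
graver⊆lattice (_ , _ , ((H⊆M , _) , _) , Hg) = proj₁ (H⊆M _ Hg)

graver-nonzero : ∀ {n} {L : SubZ n} {g : ℤⁿ n} → InGraver L g → ¬ 0ℤⁿ n ≡ g
graver-nonzero (_ , _ , minimal , Hg) = minimalGeneratingSet-nonzero minimal _ Hg

⊔-upperˡ : ∀ {n} (xs ys : ℕⁿ n) → Pointwise ℕ._≤_ xs (zipWith _⊔_ xs ys)
⊔-upperˡ []       []       = []
⊔-upperˡ (x ∷ xs) (y ∷ ys) = ℕ.m≤m⊔n x y ∷ ⊔-upperˡ xs ys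

⊔-upperʳ : ∀ {n} (xs ys : ℕⁿ n) → Pointwise ℕ._≤_ ys (zipWith _⊔_ xs ys)
⊔-upperʳ []       []       = []
⊔-upperʳ (x ∷ xs) (y ∷ ys) = ℕ.m≤n⊔m x y ∷ ⊔-upperʳ xs ys

≤-lcmExp : ∀ {m n} (α : Fin (suc m) → ℕⁿ n) j → Pointwise ℕ._≤_ (α j) (lcmExp α)
≤-lcmExp {zero}  α zero    = Pointwise.refl ℕ.≤-refl
≤-lcmExp {suc m} α zero    = ⊔-upperˡ (α zero) _
≤-lcmExp {suc m} α (suc j) =
  Pointwise.trans ℕ.≤-trans (≤-lcmExp (α ∘ suc) j) (⊔-upperʳ (α zero) _)

_+ⁿ_ _∸ⁿ_ : ∀ {n} → ℕⁿ n → ℕⁿ n → ℕⁿ n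
_+ⁿ_ = zipWith ℕ._+_
_∸ⁿ_ = zipWith _∸_

diffZ-∸+ : ∀ {n} {a v : ℕⁿ n} (b : ℕⁿ n) → Pointwise ℕ._≤_ a v →
  diffZ v ((v ∸ⁿ a) +ⁿ b) ≡ diffZ a b
diffZ-∸+ []       []         = refl
diffZ-∸+ (b ∷ bs) (a≤v ∷ as≤vs) = cong₂ _∷_ (coordinate a≤v) (diffZ-∸+ bs as≤vs)
  where
  open ≡-Reasoning
  coordinate : ∀ {a v} → a ℕ.≤ v → + v ℤ.- + ((v ∸ a) ℕ.+ b) ≡ + a ℤ.- + b
  coordinate {a} {v} a≤v = begin
    + v ℤ.- + ((v ∸ a) ℕ.+ b)        ≡⟨ cong (λ k → + v ℤ.- k) (ℤ.pos-+ (v ∸ a) b) ⟩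
    + v ℤ.- (+ (v ∸ a) ℤ.+ + b)      ≡⟨ cong (λ k → + v ℤ.- (k ℤ.+ + b)) v∸a≡v-a ⟩
    + v ℤ.- ((+ v ℤ.- + a) ℤ.+ + b)  ≡⟨ cancel (+ v) (+ a) (+ b) ⟩
    + a ℤ.- + b                      ∎
    where
    v∸a≡v-a : + (v ∸ a) ≡ + v ℤ.- + a
    v∸a≡v-a = sym (trans (ℤ.m-n≡m⊖n v a) (ℤ.⊖-≥ a≤v))
    cancel : ∀ (v a b : ℤ) → v ℤ.- ((v ℤ.- a) ℤ.+ b) ≡ a ℤ.- b
    cancel = solve-∀

diffZ-self : ∀ {n} (u : ℕⁿ n) → diffZ u u ≡ 0ℤⁿ n
diffZ-self []      = refl
diffZ-self (x ∷ u) = cong₂ _∷_ (ℤ.+-inverseʳ (+ x)) (diffZ-self u)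

-- ℤ→ℚ z is fromℚᵘ (mkℚᵘ z 0) by definition, so both facts reduce to ℚᵘ.
ℤ→ℚ-injective : ∀ {a b} → ℤ→ℚ a ≡ ℤ→ℚ b → a ≡ b
ℤ→ℚ-injective {a} {b} eq with ℚ.fromℚᵘ-injective {ℚᵘ.mkℚᵘ a 0} {ℚᵘ.mkℚᵘ b 0} eq
... | ℚᵘ.*≡* a*1≡b*1 = trans (sym (ℤ.*-identityʳ a)) (trans a*1≡b*1 (ℤ.*-identityʳ b))

ℤ→ℚ-homo-+ : ∀ a b → ℤ→ℚ (a ℤ.+ b) ≡ ℤ→ℚ a + ℤ→ℚ b
ℤ→ℚ-homo-+ a b = ℚ.toℚᵘ-injective (begin
  ℚ.toℚᵘ (ℤ→ℚ (a ℤ.+ b))              ≈⟨ ℚ.toℚᵘ-fromℚᵘ _ ⟩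
  ℚᵘ.mkℚᵘ (a ℤ.+ b) 0                  ≈⟨ ℚᵘ.*≡* (homo a b) ⟩
  ℚᵘ.mkℚᵘ a 0 ℚᵘ.+ ℚᵘ.mkℚᵘ b 0         ≈⟨ ℚᵘ.+-cong (ℚᵘ.≃-sym (ℚ.toℚᵘ-fromℚᵘ (ℚᵘ.mkℚᵘ a 0)))
                                                     (ℚᵘ.≃-sym (ℚ.toℚᵘ-fromℚᵘ (ℚᵘ.mkℚᵘ b 0))) ⟩
  ℚ.toℚᵘ (ℤ→ℚ a) ℚᵘ.+ ℚ.toℚᵘ (ℤ→ℚ b)  ≈⟨ ℚᵘ.≃-sym (ℚ.toℚᵘ-homo-+ (ℤ→ℚ a) (ℤ→ℚ b)) ⟩
  ℚ.toℚᵘ (ℤ→ℚ a + ℤ→ℚ b)              ∎)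
  where
  open ℚᵘ.≃-Reasoning
  homo : ∀ (a b : ℤ) → (a ℤ.+ b) ℤ.* + 1 ≡ (a ℤ.* + 1 ℤ.+ b ℤ.* + 1) ℤ.* + 1
  homo = solve-∀

toℚⁿ-injective : ∀ {n} {u w : ℕⁿ n} → toℚⁿ u ≡ toℚⁿ w → u ≡ w
toℚⁿ-injective {u = []}    {[]}    _  = refl
toℚⁿ-injective {u = x ∷ u} {y ∷ w} eq with Vec.∷-injective eq
... | x≡y , u≡w = cong₂ _∷_ (ℤ.+-injective (ℤ→ℚ-injective x≡y)) (toℚⁿ-injective u≡w)

toℚⁿ-split : ∀ {n} (u w : ℕⁿ n) → toℚⁿ u ≡ zipWith _+_ (toℚⁿ w) (map ℤ→ℚ (diffZ u w))
toℚⁿ-split []      []      = refl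
toℚⁿ-split (x ∷ u) (y ∷ w) = cong₂ _∷_ coordinate (toℚⁿ-split u w)
  where
  coordinate : ℕ→ℚ x ≡ ℕ→ℚ y + ℤ→ℚ (+ x ℤ.- + y)
  coordinate = trans (cong ℤ→ℚ (split (+ x) (+ y))) (ℤ→ℚ-homo-+ (+ y) (+ x ℤ.- + y))
    where
    split : ∀ (x y : ℤ) → x ≡ y ℤ.+ (x ℤ.- y)
    split = solve-∀

dot-+ʳ : ∀ {n} (d x y : ℚⁿ n) → dot d (zipWith _+_ x y) ≡ dot d x + dot d y
dot-+ʳ []       []       []       = sym (ℚ.+-identityʳ 0ℚ)
dot-+ʳ (d ∷ ds) (x ∷ xs) (y ∷ ys) =
  trans (cong (_+_ (d * (x + y))) (dot-+ʳ ds xs ys))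
        (solve 5 (λ d x y r s → d :* (x :+ y) :+ (r :+ s) := (d :* x :+ r) :+ (d :* y :+ s))
               refl d x y (dot ds xs) (dot ds ys))

dot-zeroʳ : ∀ {n} (d : ℚⁿ n) → dot d (replicate n 0ℚ) ≡ 0ℚ
dot-zeroʳ []       = refl
dot-zeroʳ (d ∷ ds) = trans (cong₂ _+_ (ℚ.*-zeroʳ d) (dot-zeroʳ ds)) (ℚ.+-identityʳ 0ℚ)

dot-scaleʳ : ∀ {n} (d : ℚⁿ n) (c : ℚ) (x : ℚⁿ n) → dot d (map (c *_) x) ≡ c * dot d x
dot-scaleʳ []       c []       = sym (ℚ.*-zeroʳ c)
dot-scaleʳ (d ∷ ds) c (x ∷ xs) =
  trans (cong (_+_ (d * (c * x))) (dot-scaleʳ ds c xs))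
        (solve 4 (λ d c x r → d :* (c :* x) :+ c :* r := c :* (d :* x :+ r))
               refl d c x (dot ds xs))

sumQ-cong : ∀ {m n} {f g : Fin m → ℚⁿ n} → (∀ j → f j ≡ g j) → sumQ f ≡ sumQ g
sumQ-cong {zero}  f≡g = refl
sumQ-cong {suc m} f≡g = cong₂ (zipWith _+_) (f≡g zero) (sumQ-cong (f≡g ∘ suc))

dot-sumQ-nonNeg : ∀ {m n} (d : ℚⁿ n) (f : Fin m → ℚⁿ n) →
  (∀ j → 0ℚ ≤ dot d (f j)) → 0ℚ ≤ dot d (sumQ f)
dot-sumQ-nonNeg {zero}  d f _   = ℚ.≤-reflexive (sym (dot-zeroʳ d))
dot-sumQ-nonNeg {suc m} d f pos = subst (0ℚ ≤_) (sym (dot-+ʳ d _ _))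
  (ℚ.+-mono-≤ (pos zero) (dot-sumQ-nonNeg d (f ∘ suc) (pos ∘ suc)))

dot-sumQ-pos : ∀ {m n} (d : ℚⁿ n) (f : Fin (suc m) → ℚⁿ n) →
  (∀ j → 0ℚ < dot d (f j)) → 0ℚ < dot d (sumQ f)
dot-sumQ-pos d f pos = subst (0ℚ <_) (sym (dot-+ʳ d _ _))
  (ℚ.+-mono-<-≤ (pos zero) (dot-sumQ-nonNeg d (f ∘ suc) (ℚ.<⇒≤ ∘ pos ∘ suc)))

*-pos : ∀ {p q} → 0ℚ < p → 0ℚ < q → 0ℚ < p * q
*-pos {p} {q} 0<p 0<q =
  ℚ.positive⁻¹ (p * q) {{ℚ.pos*pos⇒pos p {{ℚ.positive 0<p}} q {{ℚ.positive 0<q}}}}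

<+⇒pos : ∀ {p q} → p < p + q → 0ℚ < q
<+⇒pos {p} {q} p<p+q = ℚ.≰⇒> λ q≤0 → ℚ.<-irrefl refl
  (ℚ.<-≤-trans p<p+q (subst (p + q ≤_) (ℚ.+-identityʳ p) (ℚ.+-monoʳ-≤ p q≤0)))

balanced⇒¬IsVertex : ∀ {m n} {P : ℚⁿ n → Set} {w : ℚⁿ n}
  (p e : Fin (suc m) → ℚⁿ n) (c : Fin (suc m) → ℚ) →
  (∀ j → 0ℚ < c j) → (∀ j → P (p j)) → (∀ j → ¬ p j ≡ w) →
  (∀ j → w ≡ zipWith _+_ (p j) (e j)) →
  sumQ (λ j → map (c j *_) (e j)) ≡ replicate n 0ℚ →
  ¬ IsVertex P w
balanced⇒¬IsVertex p e c c-pos Pp p≢w w≡p+e balanced (_ , d , exposes) =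
  ℚ.<-irrefl refl (subst (0ℚ <_) dot-sum≡0 (dot-sumQ-pos d _ dot-term-pos))
  where
  dot-e-pos : ∀ j → 0ℚ < dot d (e j)
  dot-e-pos j with exposes (p j) (Pp j)
  ... | inj₂ p≡w  = contradiction p≡w (p≢w j)
  ... | inj₁ dp<dw =
    <+⇒pos (subst (dot d (p j) <_) (trans (cong (dot d) (w≡p+e j)) (dot-+ʳ d _ _)) dp<dw)

  dot-term-pos : ∀ j → 0ℚ < dot d (map (c j *_) (e j))
  dot-term-pos j = subst (0ℚ <_) (sym (dot-scaleʳ d (c j) (e j))) (*-pos (c-pos j) (dot-e-pos j))

  dot-sum≡0 : dot d (sumQ (λ j → map (c j *_) (e j))) ≡ 0ℚ
  dot-sum≡0 = trans (cong (dot d) balanced) (dot-zeroʳ d)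

convexHull-point : ∀ {n} {S : ℕⁿ n → Set} {w : ℕⁿ n} → S w → ConvexHull S (toℚⁿ w)
convexHull-point {n} {w = w} Sw =
  (1ℚ , w) ∷ [] , (ℚ.nonNegative⁻¹ 1ℚ , Sw) ∷ [] , ℚ.+-identityʳ 1ℚ , combination≡w
  where
  combination≡w : zipWith _+_ (map (1ℚ *_) (toℚⁿ w)) (replicate n 0ℚ) ≡ toℚⁿ w
  combination≡w = trans (Vec.zipWith-identityʳ ℚ.+-identityʳ _)
                        (trans (Vec.map-cong ℚ.*-identityˡ _) (Vec.map-id _))

lemma2p6 : (n : ℕ) (L : SubZ n) → IsLattice L →
    (m : ℕ) (α β : Fin (suc m) → ℕⁿ n) (c : Fin (suc m) → ℚ) →
    (∀ j → 0ℚ < c j) →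
    (∀ j → InGraver L (diffZ (α j) (β j))) →
    (∀ j (i : Fin n) → (lookup (α j) i ≡ 0) ⊎ (lookup (β j) i ≡ 0)) →
    sumQ (λ j → map (λ z → c j * ℤ→ℚ z) (diffZ (α j) (β j))) ≡ replicate n 0ℚ →
    InVertexIdeal L (lcmExp α)
lemma2p6 n L _ m α β c c-pos graver _ balanced =
  v , Pointwise.refl ℕ.≤-refl ,
  balanced⇒¬IsVertex (toℚⁿ ∘ p) (map ℤ→ℚ ∘ g) c c-pos
    (λ j → convexHull-point (subst L (sym (v-p≡g j)) (graver⊆lattice (graver j))))
    p≢v
    (λ j → trans (toℚⁿ-split v (p j)) (cong (zipWith _+_ (toℚⁿ (p j)) ∘ map ℤ→ℚ) (v-p≡g j)))
    (trans (sumQ-cong λ j → sym (Vec.map-∘ (c j *_) ℤ→ℚ (g j))) balanced)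
  where
  v : ℕⁿ n
  v = lcmExp α
  g : Fin (suc m) → ℤⁿ n
  g j = diffZ (α j) (β j)
  p : Fin (suc m) → ℕⁿ n
  p j = (v ∸ⁿ α j) +ⁿ β j

  v-p≡g : ∀ j → diffZ v (p j) ≡ g j
  v-p≡g j = diffZ-∸+ (β j) (≤-lcmExp α j)

  p≢v : ∀ j → ¬ toℚⁿ (p j) ≡ toℚⁿ v
  p≢v j p≡v = graver-nonzero (graver j)
    (trans (sym (diffZ-self v)) (trans (cong (diffZ v) (sym (toℚⁿ-injective p≡v))) (v-p≡g j)))
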